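{- The logic $\mathbf{WWW}$ is sound with respect to the class of all $\mathsf{WWW}$-PN-models: every formula of $\mathbf{WWW}$ is forced at every world of every $\mathsf{WWW}$-PN-model.
   Context: Formulas are built from a countable set $PV$ of propositional variables and $\bot$ by $\land,\lor,\rightarrow$ and a unary modal operator $\mathsf{W}$; $\lnot\varphi$ abbreviates $\varphi\to\bot$, $\varphi\leftrightarrow\psi$ abbreviates $(\varphi\to\psi)\land(\psi\to\varphi)$. The logic $\mathbf{WWW}$ is the smallest set of formulas containing all instances of the axiom schemes of intuitionistic propositional logic and all instances of $\mathsf{W}\varphi\to\lnot\varphi$, closed under modus ponens, the rule "from $\varphi\leftrightarrow\psi$ infer $\mathsf{W}\varphi\leftrightarrow\mathsf{W}\psi$", and the rule "from $\varphi\to\psi$ infer $(\mathsf{W}\varphi\land\lnot\psi)\to\mathsf{W}\psi$". A $\mathsf{WWW}$-PN-model is a quadruple $\langle W,\mathcal{N},\leq,V\rangle$ with $\leq$ a partial order on $W$, $\mathcal{N}:W\to P(P(W))$, $V:PV\to P(W)$ with each $V(q)$ upward closed, such that (i) if $w\leq v$, $X\in\mathcal{N}_w$ and $v\notin X$ then $X\in\mathcal{N}_v$; and (ii) (supplementation) if $X\in\mathcal{N}_w$ and $X\subseteq Y\subseteq W$ then $Y\in\mathcal{N}_w$. Forcing: $w\nVdash\bot$; $w\Vdash q$ iff $w\in V(q)$; $\land,\lor$ pointwise; $w\Vdash\varphi\to\psi$ iff for all $v\geq w$, $v\nVdash\varphi$ or $v\Vdash\psi$; $w\Vdash\mathsf{W}\varphi$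 iff $w\Vdash\lnot\varphi$ and $V(\varphi)\in\mathcal{N}_w$, where $V(\varphi)=\{z:z\Vdash\varphi\}$. -}

module Defs where

open import Data.Nat using (ℕ)
open import Data.Product using (_×_; _,_)
open import Data.Sum using (_⊎_)
open import Data.Empty using (⊥)
open import Relation.Nullary using (¬_)
open import Relation.Binary.PropositionalEquality using (_≡_)
open import Relation.Binary.Structures using (IsPartialOrder)

PV : Set
PV = ℕ

infixr 5 _⇒_
infixl 7 _∧_
infixl 6 _∨_

data Form : Set where
  var : PV → Form
  ⊥f  : Form
  _∧_ : Form → Form → Form
  _∨_ : Form → Form → Form
  _⇒_ : Form → Form → Form
  𝖶   : Form → Form

infix 8 ¬f_
¬f_ : Form → Form
¬f φ = φ ⇒ ⊥f

_⇔_ : Form → Form → Form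
φ ⇔ ψ = (φ ⇒ ψ) ∧ (ψ ⇒ φ)

data IPCAxiom : Form → Set where
  K    : ∀ φ ψ → IPCAxiom (φ ⇒ ψ ⇒ φ)
  S    : ∀ φ ψ χ → IPCAxiom ((φ ⇒ ψ ⇒ χ) ⇒ (φ ⇒ ψ) ⇒ φ ⇒ χ)
  ∧E₁  : ∀ φ ψ → IPCAxiom (φ ∧ ψ ⇒ φ)
  ∧E₂  : ∀ φ ψ → IPCAxiom (φ ∧ ψ ⇒ ψ)
  ∧I   : ∀ φ ψ → IPCAxiom (φ ⇒ ψ ⇒ φ ∧ ψ)
  ∨I₁  : ∀ φ ψ → IPCAxiom (φ ⇒ φ ∨ ψ)
  ∨I₂  : ∀ φ ψ → IPCAxiom (ψ ⇒ φ ∨ ψ)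
  ∨E   : ∀ φ ψ χ → IPCAxiom ((φ ⇒ χ) ⇒ (ψ ⇒ χ) ⇒ φ ∨ ψ ⇒ χ)
  efq  : ∀ φ → IPCAxiom (⊥f ⇒ φ)

data WWW : Form → Set where
  ipc   : ∀ {φ} → IPCAxiom φ → WWW φ
  wneg  : ∀ φ → WWW (𝖶 φ ⇒ ¬f φ)
  mp    : ∀ {φ ψ} → WWW (φ ⇒ ψ) → WWW φ → WWW ψ
  wcong : ∀ {φ ψ} → WWW (φ ⇔ ψ) → WWW (𝖶 φ ⇔ 𝖶 ψ)
  wmono : ∀ {φ ψ} → WWW (φ ⇒ ψ) → WWW (𝖶 φ ∧ ¬f ψ ⇒ 𝖶 ψ)

-- Subsets of W are predicates W → Set.
record PNModel : Set₁ where
  field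
    W     : Set
    _≤_   : W → W → Set
    isPO  : IsPartialOrder _≡_ _≤_
    𝒩     : W → (W → Set) → Set
    V     : PV → W → Set
    V-up  : ∀ q {w v} → w ≤ v → V q w → V q v
    cond-i : ∀ {w v} {X : W → Set} → w ≤ v → 𝒩 w X → ¬ X v → 𝒩 v X
    suppl  : ∀ {w} {X Y : W → Set} → 𝒩 w X → (∀ z → X z → Y z) → 𝒩 w Y

module _ (M : PNModel) where
  open PNModel M

  _⊩_ : W → Form → Set
  w ⊩ var q   = V q w
  w ⊩ ⊥f      = ⊥
  w ⊩ (φ ∧ ψ) = (w ⊩ φ) × (w ⊩ ψ)
  w ⊩ (φ ∨ ψ) = (w ⊩ φ) ⊎ (w ⊩ ψ)
  w ⊩ (φ ⇒ ψ) = ∀ v → w ≤ v → v ⊩ φ → v ⊩ ψ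
  -- w ⊩ W φ iff w ⊩ ¬φ and V(φ) ∈ 𝒩_w  (¬φ unfolded to keep termination visible)
  w ⊩ 𝖶 φ     = (∀ v → w ≤ v → v ⊩ φ → ⊥) × 𝒩 w (λ z → z ⊩ φ)

  Val : Form → W → Set
  Val φ z = z ⊩ φ

_,_⊩_ : (M : PNModel) → PNModel.W M → Form → Set
M , w ⊩ φ = _⊩_ M w φ

-- Forcing is persistent along ≤ (for
-- 𝖶-formulas this is exactly condition (i)), so the intuitionistic axioms are
-- valid as in ordinary Kripke semantics, and 𝖶 φ → ¬ φ holds by the forcing
-- clause of 𝖶. For the two rules, validity of φ → ψ gives V(φ) ⊆ V(ψ) in every
-- model, and supplementation carries V(φ) ∈ 𝒩_w over to V(ψ) ∈ 𝒩_w.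
module Submission where

open import Defs
open import Data.Product using (_×_; proj₁; proj₂) renaming (_,_ to _&_)
open import Data.Sum using (inj₁; inj₂)
open import Relation.Binary.Structures using (IsPartialOrder)
open import Relation.Unary using (_⊆′_)

Valid : Form → Set₁
Valid φ = ∀ M w → M , w ⊩ φ

module _ (M : PNModel) where
  open PNModel M
  open IsPartialOrder isPO using (refl; trans)

  ⊩-mono : ∀ φ {w v} → w ≤ v → M , w ⊩ φ → M , v ⊩ φ
  ⊩-mono (var q)  w≤v w⊩q = V-up q w≤v w⊩q
  ⊩-mono ⊥f       _   ()
  ⊩-mono (φ ∧ ψ)  w≤v (w⊩φ & w⊩ψ) = ⊩-mono φ w≤v w⊩φ & ⊩-mono ψ w≤v w⊩ψ
  ⊩-mono (φ ∨ ψ)  w≤v (inj₁ w⊩φ) = inj₁ (⊩-mono φ w≤v w⊩φ)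
  ⊩-mono (φ ∨ ψ)  w≤v (inj₂ w⊩ψ) = inj₂ (⊩-mono ψ w≤v w⊩ψ)
  ⊩-mono (φ ⇒ ψ)  w≤v w⊩φ⇒ψ u v≤u = w⊩φ⇒ψ u (trans w≤v v≤u)
  ⊩-mono (𝖶 φ) {v = v} w≤v (w⊩¬φ & Vφ∈𝒩w) =
    (λ u v≤u → w⊩¬φ u (trans w≤v v≤u)) & cond-i w≤v Vφ∈𝒩w (w⊩¬φ v w≤v)

  ⊩-mp : ∀ φ ψ {w} → M , w ⊩ (φ ⇒ ψ) → M , w ⊩ φ → M , w ⊩ ψ
  ⊩-mp _ _ {w} w⊩φ⇒ψ = w⊩φ⇒ψ w refl

  IPCAxiom-sound : ∀ {φ} → IPCAxiom φ → ∀ w → M , w ⊩ φ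
  IPCAxiom-sound (K φ ψ) _ v _ v⊩φ u v≤u _ = ⊩-mono φ v≤u v⊩φ
  IPCAxiom-sound (S φ ψ χ) _ v _ v⊩φ⇒ψ⇒χ u v≤u u⊩φ⇒ψ y u≤y y⊩φ =
    v⊩φ⇒ψ⇒χ y (trans v≤u u≤y) y⊩φ y refl (u⊩φ⇒ψ y u≤y y⊩φ)
  IPCAxiom-sound (∧E₁ φ ψ) _ _ _ = proj₁
  IPCAxiom-sound (∧E₂ φ ψ) _ _ _ = proj₂
  IPCAxiom-sound (∧I φ ψ) _ v _ v⊩φ u v≤u u⊩ψ = ⊩-mono φ v≤u v⊩φ & u⊩ψ
  IPCAxiom-sound (∨I₁ φ ψ) _ _ _ = inj₁
  IPCAxiom-sound (∨I₂ φ ψ) _ _ _ = inj₂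
  IPCAxiom-sound (∨E φ ψ χ) _ v _ v⊩φ⇒χ u v≤u u⊩ψ⇒χ y u≤y (inj₁ y⊩φ) =
    v⊩φ⇒χ y (trans v≤u u≤y) y⊩φ
  IPCAxiom-sound (∨E φ ψ χ) _ v _ v⊩φ⇒χ u v≤u u⊩ψ⇒χ y u≤y (inj₂ y⊩ψ) =
    u⊩ψ⇒χ y u≤y y⊩ψ
  IPCAxiom-sound (efq φ) _ _ _ ()

  ¬-antitone : ∀ φ ψ {w} → Val M ψ ⊆′ Val M φ → M , w ⊩ (¬f φ) → M , w ⊩ (¬f ψ)
  ¬-antitone _ _ ψ⊆φ w⊩¬φ u w≤u u⊩ψ = w⊩¬φ u w≤u (ψ⊆φ u u⊩ψ)

  𝖶-⊆ : ∀ φ ψ {w} → Val M φ ⊆′ Val M ψ → M , w ⊩ 𝖶 φ → M , w ⊩ (¬f ψ) → M , w ⊩ 𝖶 ψ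
  𝖶-⊆ _ _ φ⊆ψ (_ & Vφ∈𝒩w) w⊩¬ψ = w⊩¬ψ & suppl Vφ∈𝒩w φ⊆ψ

  𝖶-mono : ∀ φ ψ {w} → Val M φ ⊆′ Val M ψ → M , w ⊩ (𝖶 φ ∧ ¬f ψ ⇒ 𝖶 ψ)
  𝖶-mono φ ψ φ⊆ψ _ _ (v⊩𝖶φ & v⊩¬ψ) = 𝖶-⊆ φ ψ φ⊆ψ v⊩𝖶φ v⊩¬ψ

  𝖶-cong : ∀ φ ψ {w} → Val M φ ⊆′ Val M ψ → Val M ψ ⊆′ Val M φ → M , w ⊩ (𝖶 φ ⇔ 𝖶 ψ)
  𝖶-cong φ ψ φ⊆ψ ψ⊆φ = 𝖶-transport φ ψ φ⊆ψ ψ⊆φ & 𝖶-transport ψ φ ψ⊆φ φ⊆ψ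
    where
    𝖶-transport : ∀ α β {w} → Val M α ⊆′ Val M β → Val M β ⊆′ Val M α → M , w ⊩ (𝖶 α ⇒ 𝖶 β)
    𝖶-transport α β α⊆β β⊆α _ _ v⊩𝖶α =
      𝖶-⊆ α β α⊆β v⊩𝖶α (¬-antitone α β β⊆α (proj₁ v⊩𝖶α))

valid⇒-⊆ : ∀ φ ψ → Valid (φ ⇒ ψ) → ∀ M → Val M φ ⊆′ Val M ψ
valid⇒-⊆ φ ψ ⊨φ⇒ψ M z = ⊩-mp M φ ψ (⊨φ⇒ψ M z)

valid⇔-⊆ : ∀ φ ψ → Valid (φ ⇔ ψ) → ∀ M → Val M φ ⊆′ Val M ψ × Val M ψ ⊆′ Val M φ
valid⇔-⊆ φ ψ ⊨φ⇔ψ M =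
  valid⇒-⊆ φ ψ (λ M z → proj₁ (⊨φ⇔ψ M z)) M & valid⇒-⊆ ψ φ (λ M z → proj₂ (⊨φ⇔ψ M z)) M

mainTheorem7 : ∀ {φ} → WWW φ → (M : PNModel) → (w : PNModel.W M) → M , w ⊩ φ
mainTheorem7 (ipc ax) M w = IPCAxiom-sound M ax w
mainTheorem7 (wneg φ) M w _ _ = proj₁
mainTheorem7 (mp {φ} {ψ} ⊢φ⇒ψ ⊢φ) M w = ⊩-mp M φ ψ (mainTheorem7 ⊢φ⇒ψ M w) (mainTheorem7 ⊢φ M w)
mainTheorem7 (wcong {φ} {ψ} ⊢φ⇔ψ) M w =
  let φ⊆ψ & ψ⊆φ = valid⇔-⊆ φ ψ (mainTheorem7 ⊢φ⇔ψ) M in 𝖶-cong M φ ψ φ⊆ψ ψ⊆φ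
mainTheorem7 (wmono {φ} {ψ} ⊢φ⇒ψ) M w = 𝖶-mono M φ ψ (valid⇒-⊆ φ ψ (mainTheorem7 ⊢φ⇒ψ) M)
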